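{- Let $n\ge2$, $J:=\{2,3,\dots,n-2\}$, and let $w:=(1\ n)\in\mathfrak{S}_n$ be the transposition exchanging $1$ and $n$ (so $w\in W^J$). Then for all $j\in J$, the Bruhat intervals $[e,w]$ and $[s_j,w]$ are equal modulo $W_J$, i.e. $\{xW_J: x\in[e,w]\}=\{xW_J:x\in[s_j,w]\}$.
   Context: $W=\mathfrak{S}_n$ is the symmetric group, $e$ its identity, $s_i=(i\ i{+}1)$ for $1\le i\le n-1$ the simple transpositions, and $\le$ the (strong) Bruhat order: $v\le w$ iff some (equivalently every) reduced word for $w$ contains a subword that is a reduced word for $v$; $[v,w]=\{x: v\le x\le w\}$. For $J\subseteq[n-1]$, $W_J$ is the subgroup generated by $\{s_j:j\in J\}$, and $W^J=\{w\in\mathfrak{S}_n: w(j)<w(j+1)\text{ for all }j\in J\}$ is the set of minimal-length coset representatives of $W/W_J$. -}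

module Defs where

open import Data.Nat using (ℕ; zero; suc; _+_; _≤_)
open import Data.Fin using (Fin; toℕ; inject₁; fromℕ)
import Data.Fin as F
open import Data.List using (List; []; _∷_; length)
open import Data.List.Relation.Unary.All using (All)
open import Data.List.Relation.Binary.Sublist.Propositional using (_⊆_)
open import Data.Product using (Σ; _×_; _,_)
open import Data.Fin.Permutation using (Permutation′; _∘ₚ_; transpose; flip; _≈_)
import Data.Fin.Permutation as P

-- Throughout, n = suc m, and Fin (suc m) = {0,…,m} encodes {1,…,n} (k ↦ k+1).

S : ℕ → Set
S m = Permutation′ (suc m)

-- Group product in the usual (right-to-left) convention: (x · y)(i) = x (y i).
_·_ : ∀ {m} → S m → S m → S m
x · y = y ∘ₚ x

e : ∀ {m} → S m
e = P.id

_⁻¹ : ∀ {m} → S m → S m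
x ⁻¹ = flip x

-- Simple transposition: the letter k : Fin m denotes s_{k+1} = (k+1  k+2)
-- (1-indexed), i.e. it swaps the 0-indexed positions k and k+1.
s : ∀ {m} → Fin m → S m
s k = transpose (inject₁ k) (F.suc k)

Word : ℕ → Set
Word m = List (Fin m)

eval : ∀ {m} → Word m → S m
eval []       = e
eval (k ∷ ks) = s k · eval ks

Reduced : ∀ {m} → Word m → Set
Reduced {m} ws = (vs : Word m) → eval vs ≈ eval ws → length ws ≤ length vs

_≤B_ : ∀ {m} → S m → S m → Set
_≤B_ {m} v w = Σ (Word m) λ ws → Σ (Word m) λ us →
  Reduced ws × eval ws ≈ w × us ⊆ ws × Reduced us × eval us ≈ v

_∈[_,_] : ∀ {m} → S m → S m → S m → Set
x ∈[ v , w ] = (v ≤B x) × (x ≤B w)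

-- W_J = subgroup generated by {s_j : j ∈ J}; since the s_j are involutions in
-- a finite group, this is the set of products of words with letters in J.
InW : ∀ {m} → (Fin m → Set) → S m → Set
InW {m} J x = Σ (Word m) λ ws → All J ws × eval ws ≈ x

SameCoset : ∀ {m} → (Fin m → Set) → S m → S m → Set
SameCoset J x y = InW J ((x ⁻¹) · y)

EqualModulo : ∀ {m} → (Fin m → Set) → S m → S m → S m → Set
EqualModulo {m} J a b w =
  ((x : S m) → x ∈[ a , w ] → Σ (S m) λ y → y ∈[ b , w ] × SameCoset J x y) ×
  ((y : S m) → y ∈[ b , w ] → Σ (S m) λ x → x ∈[ a , w ] × SameCoset J x y)

-- J = {2,3,…,n-2} (1-indexed simple reflections). Letter k is s_{k+1}, so
-- k ∈ J iff 2 ≤ k+1 ≤ n-2 = m-1, i.e. 1 ≤ k and k+2 ≤ m.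
Jmid : ∀ {m} → Fin m → Set
Jmid {m} k = (1 ≤ toℕ k) × (toℕ k + 2 ≤ m)

w1n : ∀ {m} → S m
w1n {m} = transpose F.zero (fromℕ m)

{-# OPTIONS --safe #-}
-- Since s_2, …, s_{n-2} generate all permutations of {2, …, n-1}, two permutations lie in
-- the same coset of W_J as soon as they agree at 1 and at n.  Every y ∈ [s_j, w] lies in
-- [e, w].  Conversely, let x ≤ w.  If a reduced word of x contains s_j, then s_j ≤ x.
-- Otherwise x preserves {1, …, j}, so x(1) ≤ j < x(n), and the reduced word
-- s_1 ⋯ s_{n-1} s_{n-2} ⋯ s_1 of w has a subword through s_j whose product y satisfies
-- y(1) = x(1) and y(n) = x(n).  Every word used is certified reduced by showing that its
-- length equals its number of inversions, which is a lower bound for the length of any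
-- word with the same product.
module Submission where

open import Defs
open import Data.Nat
open import Data.Nat.Properties
open import Data.Fin as F using (Fin; toℕ; fromℕ; fromℕ<; inject₁)
open import Data.Fin.Properties using (toℕ-injective; toℕ-inject₁; toℕ-fromℕ; toℕ-fromℕ<; toℕ<n)
open import Data.Fin.Permutation using (_⟨$⟩ʳ_; _⟨$⟩ˡ_; inverseˡ; inverseʳ; transpose; _≈_)
open import Data.Empty using (⊥-elim)
open import Data.List using (List; []; _∷_; _++_; length; map)
open import Data.List.Properties using (length-map)
open import Data.List.Relation.Unary.All using (All; []; _∷_)
import Data.List.Relation.Unary.All as All
import Data.List.Relation.Unary.All.Properties as All
open import Data.List.Relation.Unary.Any using (here; there; any?)
open import Data.List.Membership.Propositional using (_∈_)
open import Data.List.Membership.Propositional.Properties using (∈-++⁺ʳ)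
open import Data.List.Relation.Binary.Sublist.Propositional
  using (_⊆_; []; _∷_; _∷ʳ_; ⊆-refl; minimum; from∈)
open import Data.List.Relation.Binary.Sublist.Propositional.Properties using (++⁺; All-resp-⊆)
import Data.List.Relation.Binary.Sublist.Heterogeneous as Sublist
import Data.List.Relation.Binary.Sublist.Heterogeneous.Properties as Sublist
open import Data.Product using (Σ; _×_; _,_; proj₁; proj₂)
open import Data.Sum using (_⊎_; inj₁; inj₂)
open import Function using (_∘_)
open import Function.Definitions using (Injective)
open import Relation.Nullary using (Dec; yes; no; ¬_)
open import Relation.Binary using (tri<; tri≈; tri>)
open import Relation.Binary.PropositionalEquality

swapℕ : ℕ → ℕ → ℕ → ℕ
swapℕ a b v with v ≟ a
... | yes _ = b
... | no _ with v ≟ b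
...   | yes _ = a
...   | no _  = v

data SwapView (a b v : ℕ) : ℕ → Set where
  at-left  : v ≡ a → SwapView a b v b
  at-right : v ≢ a → v ≡ b → SwapView a b v a
  away     : v ≢ a → v ≢ b → SwapView a b v v

swap-view : ∀ a b v → SwapView a b v (swapℕ a b v)
swap-view a b v with v ≟ a
... | yes v≡a = at-left v≡a
... | no v≢a with v ≟ b
...   | yes v≡b = at-right v≢a v≡b
...   | no v≢b  = away v≢a v≢b

swapℕ-left : ∀ a b → swapℕ a b a ≡ b
swapℕ-left a b with swapℕ a b a | swap-view a b a
... | _ | at-left _      = refl
... | _ | at-right a≢a _ = ⊥-elim (a≢a refl)
... | _ | away a≢a _     = ⊥-elim (a≢a refl)

swapℕ-right : ∀ a b → swapℕ a b b ≡ a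
swapℕ-right a b with swapℕ a b b | swap-view a b b
... | _ | at-left b≡a    = b≡a
... | _ | at-right _ _   = refl
... | _ | away _ b≢b     = ⊥-elim (b≢b refl)

swapℕ-away : ∀ a b {v} → v ≢ a → v ≢ b → swapℕ a b v ≡ v
swapℕ-away a b {v} v≢a v≢b with swapℕ a b v | swap-view a b v
... | _ | at-left v≡a    = ⊥-elim (v≢a v≡a)
... | _ | at-right _ v≡b = ⊥-elim (v≢b v≡b)
... | _ | away _ _       = refl

swapℕ-involutive : ∀ a b v → swapℕ a b (swapℕ a b v) ≡ v
swapℕ-involutive a b v with swapℕ a b v | swap-view a b v
... | _ | at-left refl    = swapℕ-right a b
... | _ | at-right _ refl = swapℕ-left a b
... | _ | away v≢a v≢b    = swapℕ-away a b v≢a v≢b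

τ : ℕ → ℕ → ℕ
τ k = swapℕ k (suc k)

τ-left : ∀ k → τ k k ≡ suc k
τ-left k = swapℕ-left k (suc k)

τ-right : ∀ k → τ k (suc k) ≡ k
τ-right k = swapℕ-right k (suc k)

τ-involutive : ∀ k v → τ k (τ k v) ≡ v
τ-involutive k = swapℕ-involutive k (suc k)

τ-injective : ∀ k {u v} → τ k u ≡ τ k v → u ≡ v
τ-injective k {u} {v} eq = begin
  u             ≡⟨ sym (τ-involutive k u) ⟩
  τ k (τ k u)   ≡⟨ cong (τ k) eq ⟩
  τ k (τ k v)   ≡⟨ τ-involutive k v ⟩
  v             ∎
  where open ≡-Reasoning

τ-mono-< : ∀ k {u v} → (u ≡ k → v ≢ suc k) → u < v → τ k u < τ k v
τ-mono-< k {u} {v} apart u<v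
  with τ k u | swap-view k (suc k) u | τ k v | swap-view k (suc k) v
... | _ | at-left refl     | _ | at-left refl     = ⊥-elim (<-irrefl refl u<v)
... | _ | at-left refl     | _ | at-right _ refl  = ⊥-elim (apart refl refl)
... | _ | at-left refl     | _ | away _ v≢k+1     = ≤∧≢⇒< u<v (v≢k+1 ∘ sym)
... | _ | at-right _ refl  | _ | at-left refl     = ⊥-elim (<-asym (n<1+n k) u<v)
... | _ | at-right _ refl  | _ | at-right _ refl  = ⊥-elim (<-irrefl refl u<v)
... | _ | at-right _ refl  | _ | away _ _         = <-trans (n<1+n k) u<v
... | _ | away _ _         | _ | at-left refl     = m<n⇒m<1+n u<v
... | _ | away u≢k _       | _ | at-right _ refl  = ≤∧≢⇒< (s≤s⁻¹ u<v) u≢k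
... | _ | away _ _         | _ | away _ _         = u<v

bit : {P : Set} → Dec P → ℕ
bit (yes _) = 1
bit (no _)  = 0

bit-cong : {P Q : Set} → (P → Q) → (Q → P) → (p : Dec P) (q : Dec Q) → bit p ≡ bit q
bit-cong _ _ (yes _) (yes _) = refl
bit-cong f _ (yes p) (no ¬q) = ⊥-elim (¬q (f p))
bit-cong _ g (no ¬p) (yes q) = ⊥-elim (¬p (g q))
bit-cong _ _ (no _)  (no _)  = refl

⟦_<_⟧ : ℕ → ℕ → ℕ
⟦ a < b ⟧ = bit (a <? b)

⟦<⟧-yes : ∀ {a b} → a < b → ⟦ a < b ⟧ ≡ 1
⟦<⟧-yes {a} {b} a<b with a <? b
... | yes _  = refl
... | no a≮b = ⊥-elim (a≮b a<b)

⟦<⟧-no : ∀ {a b} → ¬ a < b → ⟦ a < b ⟧ ≡ 0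
⟦<⟧-no {a} {b} a≮b with a <? b
... | yes a<b = ⊥-elim (a≮b a<b)
... | no _    = refl

τ-preserves-⟦<⟧ : ∀ k {u v} → (u ≡ k → v ≢ suc k) → (u ≡ suc k → v ≢ k) →
                  ⟦ τ k u < τ k v ⟧ ≡ ⟦ u < v ⟧
τ-preserves-⟦<⟧ k {u} {v} apart apart′ =
  bit-cong backward (τ-mono-< k apart) (τ k u <? τ k v) (u <? v)
  where
  backward : τ k u < τ k v → u < v
  backward lt = subst₂ _<_ (τ-involutive k u) (τ-involutive k v) (τ-mono-< k apart″ lt)
    where
    apart″ : τ k u ≡ k → τ k v ≢ suc k
    apart″ τu≡k τv≡k+1 = apart′ (τ-injective k (trans τu≡k (sym (τ-right k))))
                                (τ-injective k (trans τv≡k+1 (sym (τ-left k))))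

∑< : ℕ → (ℕ → ℕ) → ℕ
∑< zero    f = 0
∑< (suc n) f = ∑< n f + f n

∑<-cong : ∀ n {f g : ℕ → ℕ} → (∀ {i} → i < n → f i ≡ g i) → ∑< n f ≡ ∑< n g
∑<-cong zero    _  = refl
∑<-cong (suc n) eq = cong₂ _+_ (∑<-cong n (eq ∘ m<n⇒m<1+n)) (eq ≤-refl)

∑<-zero : ∀ n {f : ℕ → ℕ} → (∀ {i} → i < n → f i ≡ 0) → ∑< n f ≡ 0
∑<-zero zero    _  = refl
∑<-zero (suc n) eq = cong₂ _+_ (∑<-zero n (eq ∘ m<n⇒m<1+n)) (eq ≤-refl)

∑<-bump : ∀ n {f g : ℕ → ℕ} {Q} → Q < n → (∀ {i} → i < n → i ≢ Q → f i ≡ g i) →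
          f Q ≡ suc (g Q) → ∑< n f ≡ suc (∑< n g)
∑<-bump (suc n) {f} {g} {Q} Q<n eq eqQ with Q ≟ n
... | yes refl = begin
  ∑< Q f + f Q         ≡⟨ cong₂ _+_ (∑<-cong Q (λ i<Q → eq (m<n⇒m<1+n i<Q) (<⇒≢ i<Q))) eqQ ⟩
  ∑< Q g + suc (g Q)   ≡⟨ +-suc (∑< Q g) (g Q) ⟩
  suc (∑< Q g + g Q)   ∎
  where open ≡-Reasoning
... | no Q≢n = cong₂ _+_ (∑<-bump n (≤∧≢⇒< (s≤s⁻¹ Q<n) Q≢n) (eq ∘ m<n⇒m<1+n) eqQ)
                         (eq ≤-refl (Q≢n ∘ sym))

inversions : ℕ → (ℕ → ℕ) → ℕ
inversions n f = ∑< n λ q → ∑< q λ p → ⟦ f q < f p ⟧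

inversions-cong : ∀ n {f g : ℕ → ℕ} → (∀ {i} → i < n → f i ≡ g i) →
                  inversions n f ≡ inversions n g
inversions-cong n eq =
  ∑<-cong n λ q<n → ∑<-cong _ λ p<q → cong₂ ⟦_<_⟧ (eq q<n) (eq (<-trans p<q q<n))

inversions-id : ∀ n → inversions n (λ v → v) ≡ 0
inversions-id n = ∑<-zero n λ {q} _ → ∑<-zero q λ p<q → ⟦<⟧-no (<-asym p<q)

inversions-τ : ∀ n {f} → Injective _≡_ _≡_ f → ∀ k {P Q} → P < Q → Q < n →
               f P ≡ k → f Q ≡ suc k → inversions n (τ k ∘ f) ≡ suc (inversions n f)
inversions-τ n {f} inj k {P} {Q} P<Q Q<n fP≡k fQ≡k+1 = ∑<-bump n Q<n otherRow rowQ
  where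
  open ≡-Reasoning
  otherRow : ∀ {q} → q < n → q ≢ Q →
             ∑< q (λ p → ⟦ τ k (f q) < τ k (f p) ⟧) ≡ ∑< q (λ p → ⟦ f q < f p ⟧)
  otherRow {q} _ q≢Q = ∑<-cong q λ {p} p<q → τ-preserves-⟦<⟧ k
    (λ fq≡k fp≡k+1 → <-asym P<Q (subst₂ _<_ (inj (trans fp≡k+1 (sym fQ≡k+1)))
                                              (inj (trans fq≡k (sym fP≡k))) p<q))
    (λ fq≡k+1 _ → q≢Q (inj (trans fq≡k+1 (sym fQ≡k+1))))
  rowQ : ∑< Q (λ p → ⟦ τ k (f Q) < τ k (f p) ⟧) ≡ suc (∑< Q (λ p → ⟦ f Q < f p ⟧))
  rowQ = ∑<-bump Q P<Q
    (λ {p} _ p≢P → τ-preserves-⟦<⟧ k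
       (λ fQ≡k → ⊥-elim (1+n≢n (trans (sym fQ≡k+1) fQ≡k)))
       (λ _ fp≡k → p≢P (inj (trans fp≡k (sym fP≡k)))))
    (begin
      ⟦ τ k (f Q) < τ k (f P) ⟧   ≡⟨ cong₂ (λ a b → ⟦ τ k a < τ k b ⟧) fQ≡k+1 fP≡k ⟩
      ⟦ τ k (suc k) < τ k k ⟧     ≡⟨ cong₂ ⟦_<_⟧ (τ-right k) (τ-left k) ⟩
      ⟦ k < suc k ⟧               ≡⟨ ⟦<⟧-yes (n<1+n k) ⟩
      1                           ≡⟨ cong suc (sym (⟦<⟧-no (<-asym (n<1+n k)))) ⟩
      suc ⟦ suc k < k ⟧           ≡⟨ cong₂ (λ a b → suc ⟦ a < b ⟧) (sym fQ≡k+1) (sym fP≡k) ⟩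
      suc ⟦ f Q < f P ⟧           ∎)

act : List ℕ → ℕ → ℕ
act []       v = v
act (k ∷ ks) v = τ k (act ks v)

unact : List ℕ → ℕ → ℕ
unact []       v = v
unact (k ∷ ks) v = unact ks (τ k v)

act-unact : ∀ ks v → act ks (unact ks v) ≡ v
act-unact []       v = refl
act-unact (k ∷ ks) v = trans (cong (τ k) (act-unact ks (τ k v))) (τ-involutive k v)

act-injective : ∀ ks → Injective _≡_ _≡_ (act ks)
act-injective []       eq = eq
act-injective (k ∷ ks) eq = act-injective ks (τ-injective k eq)

act-++ : ∀ ks ls v → act (ks ++ ls) v ≡ act ks (act ls v)
act-++ []       ls v = refl
act-++ (k ∷ ks) ls v = cong (τ k) (act-++ ks ls v)

Letters< : ℕ → List ℕ → Set
Letters< n = All (λ k → suc k < n)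

τ-< : ∀ {n k v} → suc k < n → v < n → τ k v < n
τ-< {n} {k} {v} k+1<n v<n with τ k v | swap-view k (suc k) v
... | _ | at-left _      = k+1<n
... | _ | at-right _ _   = <-trans (n<1+n k) k+1<n
... | _ | away _ _       = v<n

unact-< : ∀ {n ks v} → Letters< n ks → v < n → unact ks v < n
unact-< []         v<n = v<n
unact-< (k<n ∷ ks) v<n = unact-< ks (τ-< k<n v<n)

inversions-act-∷ : ∀ n {k ks} → Letters< n (k ∷ ks) →
                   inversions n (act (k ∷ ks)) ≡ suc (inversions n (act ks))
                   ⊎ suc (inversions n (act (k ∷ ks))) ≡ inversions n (act ks)
inversions-act-∷ n {k} {ks} (k+1<n ∷ letters) with <-cmp P Q
  where
  P Q : ℕ
  P = unact ks k
  Q = unact ks (suc k)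
... | tri< P<Q _ _ = inj₁ (inversions-τ n (act-injective ks) k P<Q
                            (unact-< letters k+1<n) (act-unact ks k) (act-unact ks (suc k)))
... | tri≈ _ P≡Q _ = ⊥-elim (1+n≢n (sym (begin
        k                   ≡⟨ sym (act-unact ks k) ⟩
        act ks (unact ks k) ≡⟨ cong (act ks) P≡Q ⟩
        act ks (unact ks (suc k)) ≡⟨ act-unact ks (suc k) ⟩
        suc k               ∎)))
  where open ≡-Reasoning
... | tri> _ _ Q<P = inj₂ (begin
        suc (inversions n (act (k ∷ ks)))   ≡⟨ sym (inversions-τ n (act-injective (k ∷ ks)) k Q<P
                                                  (unact-< letters (<-trans (n<1+n k) k+1<n)) gQ≡k gP≡k+1) ⟩
        inversions n (τ k ∘ act (k ∷ ks))    ≡⟨ inversions-cong n (λ {v} _ → τ-involutive k (act ks v)) ⟩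
        inversions n (act ks)                ∎)
  where
  open ≡-Reasoning
  gQ≡k : act (k ∷ ks) (unact ks (suc k)) ≡ k
  gQ≡k = trans (cong (τ k) (act-unact ks (suc k))) (τ-right k)
  gP≡k+1 : act (k ∷ ks) (unact ks k) ≡ suc k
  gP≡k+1 = trans (cong (τ k) (act-unact ks k)) (τ-left k)

inversions-act-≤-length : ∀ n {ks} → Letters< n ks → inversions n (act ks) ≤ length ks
inversions-act-≤-length n {[]}     []                  = ≤-reflexive (inversions-id n)
inversions-act-≤-length n {k ∷ ks} letters@(_ ∷ letters′) with inversions-act-∷ n letters
... | inj₁ eq = subst (_≤ suc (length ks)) (sym eq) (s≤s (inversions-act-≤-length n letters′))
... | inj₂ eq = ≤-trans (n≤1+n _)
                  (≤-trans (≤-reflexive eq) (m≤n⇒m≤1+n (inversions-act-≤-length n letters′)))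

-- With inversions-act-≤-length, this says that the length is the number of inversions.
Tight : ℕ → List ℕ → Set
Tight n l = length l ≤ inversions n (act l)

tight-∷ : ∀ n {k ks P Q} → Tight n ks → P < Q → Q < n → act ks P ≡ k → act ks Q ≡ suc k →
          Tight n (k ∷ ks)
tight-∷ n {ks = ks} tight P<Q Q<n P↦k Q↦k+1 =
  subst (suc (length ks) ≤_) (sym (inversions-τ n (act-injective ks) _ P<Q Q<n P↦k Q↦k+1)) (s≤s tight)

ascRun : ℕ → ℕ → List ℕ
ascRun d zero    = []
ascRun d (suc r) = d ∷ ascRun (suc d) r

descRun : ℕ → ℕ → List ℕ
descRun d zero    = []
descRun d (suc r) = d + r ∷ descRun d r

τ-below : ∀ k {v} → v < k → τ k v ≡ v
τ-below k v<k = swapℕ-away k (suc k) (<⇒≢ v<k) (<⇒≢ (m<n⇒m<1+n v<k))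

τ-above : ∀ k {v} → suc k < v → τ k v ≡ v
τ-above k k+1<v = swapℕ-away k (suc k) (>⇒≢ (<-trans (n<1+n k) k+1<v)) (>⇒≢ k+1<v)

τ-keeps-above : ∀ j {i} → j < i → j ≤ τ j i
τ-keeps-above j {i} j<i with τ j i | swap-view j (suc j) i
... | _ | at-left i≡j    = ⊥-elim (<-irrefl (sym i≡j) j<i)
... | _ | at-right _ _   = ≤-refl
... | _ | away _ _       = <⇒≤ j<i

ascRun-below : ∀ d r {v} → v < d → act (ascRun d r) v ≡ v
ascRun-below d zero    v<d = refl
ascRun-below d (suc r) v<d =
  trans (cong (τ d) (ascRun-below (suc d) r (m<n⇒m<1+n v<d))) (τ-below d v<d)

ascRun-above : ∀ d r {v} → d + r < v → act (ascRun d r) v ≡ v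
ascRun-above d zero    _      = refl
ascRun-above d (suc r) {v} d+r+1<v =
  trans (cong (τ d) (ascRun-above (suc d) r d+r+1<v′))
        (τ-above d (≤-<-trans (s≤s (m≤m+n d r)) d+r+1<v′))
  where
  d+r+1<v′ : suc (d + r) < v
  d+r+1<v′ = subst (_< v) (+-suc d r) d+r+1<v

ascRun-top : ∀ d r → act (ascRun d r) (d + r) ≡ d
ascRun-top d zero    = +-identityʳ d
ascRun-top d (suc r) = begin
  τ d (act (ascRun (suc d) r) (d + suc r))   ≡⟨ cong (τ d ∘ act (ascRun (suc d) r)) (+-suc d r) ⟩
  τ d (act (ascRun (suc d) r) (suc d + r))   ≡⟨ cong (τ d) (ascRun-top (suc d) r) ⟩
  τ d (suc d)                                ≡⟨ τ-right d ⟩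
  d                                          ∎
  where open ≡-Reasoning

ascRun-shift : ∀ d r {v} → d ≤ v → v < d + r → act (ascRun d r) v ≡ suc v
ascRun-shift d zero    d≤v v<d+0 = ⊥-elim (<⇒≱ (subst (_ <_) (+-identityʳ d) v<d+0) d≤v)
ascRun-shift d (suc r) {v} d≤v v<d+r+1 with d ≟ v
... | yes refl = trans (cong (τ d) (ascRun-below (suc d) r (n<1+n d))) (τ-left d)
... | no d≢v   = trans (cong (τ d) (ascRun-shift (suc d) r d<v (subst (v <_) (+-suc d r) v<d+r+1)))
                       (τ-above d (s≤s d<v))
  where
  d<v : d < v
  d<v = ≤∧≢⇒< d≤v d≢v

descRun-below : ∀ d r {v} → v < d → act (descRun d r) v ≡ v
descRun-below d zero    v<d = refl
descRun-below d (suc r) v<d =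
  trans (cong (τ (d + r)) (descRun-below d r v<d)) (τ-below (d + r) (<-≤-trans v<d (m≤m+n d r)))

descRun-above : ∀ d r {v} → d + r < v → act (descRun d r) v ≡ v
descRun-above d zero    _       = refl
descRun-above d (suc r) {v} d+r+1<v =
  trans (cong (τ (d + r)) (descRun-above d r (<-trans (n<1+n _) d+r+1<v′)))
        (τ-above (d + r) d+r+1<v′)
  where
  d+r+1<v′ : suc (d + r) < v
  d+r+1<v′ = subst (_< v) (+-suc d r) d+r+1<v

descRun-bottom : ∀ d r → act (descRun d r) d ≡ d + r
descRun-bottom d zero    = sym (+-identityʳ d)
descRun-bottom d (suc r) = begin
  τ (d + r) (act (descRun d r) d)   ≡⟨ cong (τ (d + r)) (descRun-bottom d r) ⟩
  τ (d + r) (d + r)                 ≡⟨ τ-left (d + r) ⟩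
  suc (d + r)                       ≡⟨ sym (+-suc d r) ⟩
  d + suc r                         ∎
  where open ≡-Reasoning

descRun-shift : ∀ d r {v} → d ≤ v → v < d + r → act (descRun d r) (suc v) ≡ v
descRun-shift d zero    d≤v v<d+0 = ⊥-elim (<⇒≱ (subst (_ <_) (+-identityʳ d) v<d+0) d≤v)
descRun-shift d (suc r) {v} d≤v v<d+r+1 with v ≟ d + r
... | yes refl = trans (cong (τ (d + r)) (descRun-above d r (n<1+n _))) (τ-right (d + r))
... | no v≢d+r = trans (cong (τ (d + r)) (descRun-shift d r d≤v v<d+r)) (τ-below (d + r) v<d+r)
  where
  v<d+r : v < d + r
  v<d+r = ≤∧≢⇒< (s≤s⁻¹ (subst (v <_) (+-suc d r) v<d+r+1)) v≢d+r

tight-descRun : ∀ n d r → d + r < n → Tight n (descRun d r)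
tight-descRun n d zero    _         = z≤n
tight-descRun n d (suc r) d+r+1<n =
  tight-∷ n {ks = descRun d r} (tight-descRun n d r (<-trans (n<1+n _) d+r+1<n′))
          (s≤s (m≤m+n d r)) d+r+1<n′ (descRun-bottom d r) (descRun-above d r (n<1+n _))
  where
  d+r+1<n′ : suc (d + r) < n
  d+r+1<n′ = subst (_< n) (+-suc d r) d+r+1<n

tight-ascRun-++ : ∀ n d r {rest Q} → Tight n rest → Q < n → act rest Q ≡ d + r →
                  (∀ {i} → d ≤ i → i < d + r → Σ ℕ λ P → P < Q × act rest P ≡ i) →
                  Tight n (ascRun d r ++ rest)
tight-ascRun-++ n d zero    tight _   _      _        = tight
tight-ascRun-++ n d (suc r) {rest} {Q} tight Q<n Q↦top preimage with preimage ≤-refl (m<m+n d z<s)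
... | P , P<Q , P↦d = tight-∷ n {ks = ascRun (suc d) r ++ rest} tight′ P<Q Q<n
        (trans (act-++ (ascRun (suc d) r) rest P)
               (trans (cong (act (ascRun (suc d) r)) P↦d) (ascRun-below (suc d) r (n<1+n d))))
        (trans (act-++ (ascRun (suc d) r) rest Q)
               (trans (cong (act (ascRun (suc d) r)) Q↦top′) (ascRun-top (suc d) r)))
  where
  Q↦top′ : act rest Q ≡ suc d + r
  Q↦top′ = trans Q↦top (+-suc d r)
  tight′ : Tight n (ascRun (suc d) r ++ rest)
  tight′ = tight-ascRun-++ n (suc d) r tight Q<n Q↦top′
             (λ {i} d<i i<d+r → preimage (<⇒≤ d<i) (subst (i <_) (sym (+-suc d r)) i<d+r))

ascRun-⊆ : ∀ d r {d′ r′} → d ≤ d′ → d′ + r′ ≤ d + r → ascRun d′ r′ ⊆ ascRun d r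
ascRun-⊆ d r       {r′ = zero}   _    _  = minimum _
ascRun-⊆ d zero    {d′} {suc r′} d≤d′ le = ⊥-elim (<-irrefl refl (begin-strict
  d′             <⟨ s≤s (m≤m+n d′ r′) ⟩
  suc (d′ + r′)  ≡⟨ sym (+-suc d′ r′) ⟩
  d′ + suc r′    ≤⟨ le ⟩
  d + zero       ≡⟨ +-identityʳ d ⟩
  d              ≤⟨ d≤d′ ⟩
  d′             ∎))
  where open ≤-Reasoning
ascRun-⊆ d (suc r) {d′} {suc r′} d≤d′ le with d ≟ d′
... | yes refl = refl ∷ ascRun-⊆ (suc d) r ≤-refl (subst₂ _≤_ (+-suc d r′) (+-suc d r) le)
... | no d≢d′  =
  d ∷ʳ ascRun-⊆ (suc d) r (≤∧≢⇒< d≤d′ d≢d′) (subst (d′ + suc r′ ≤_) (+-suc d r) le)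

ascRun-∷-⊆ : ∀ d r {k d′ r′} → d ≤ k → k < d′ → d′ + r′ ≤ d + r →
             (k ∷ ascRun d′ r′) ⊆ ascRun d r
ascRun-∷-⊆ d zero    {k} {d′} {r′} d≤k k<d′ le = ⊥-elim (<-irrefl refl (begin-strict
  k         <⟨ k<d′ ⟩
  d′        ≤⟨ m≤m+n d′ r′ ⟩
  d′ + r′   ≤⟨ le ⟩
  d + zero  ≡⟨ +-identityʳ d ⟩
  d         ≤⟨ d≤k ⟩
  k         ∎))
  where open ≤-Reasoning
ascRun-∷-⊆ d (suc r) {k} {d′} {r′} d≤k k<d′ le with d ≟ k
... | yes refl = refl ∷ ascRun-⊆ (suc d) r k<d′ (subst (d′ + r′ ≤_) (+-suc d r) le)
... | no d≢k   =
  d ∷ʳ ascRun-∷-⊆ (suc d) r (≤∧≢⇒< d≤k d≢k) k<d′ (subst (d′ + r′ ≤_) (+-suc d r) le)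

descRun-⊆ : ∀ {t r} → t ≤ r → descRun 0 t ⊆ descRun 0 r
descRun-⊆ {r = zero}  z≤n = []
descRun-⊆ {t} {suc r} t≤r+1 with t ≟ suc r
... | yes refl = ⊆-refl
... | no t≢r+1 = r ∷ʳ descRun-⊆ (s≤s⁻¹ (≤∧≢⇒< t≤r+1 t≢r+1))

descRun-∷-⊆ : ∀ {t j r} → t ≤ j → j < r → (j ∷ descRun 0 t) ⊆ descRun 0 r
descRun-∷-⊆ {j = j} {suc r} t≤j j<r+1 with j ≟ r
... | yes refl = refl ∷ descRun-⊆ t≤j
... | no j≢r   = r ∷ʳ descRun-∷-⊆ t≤j (≤∧≢⇒< (s≤s⁻¹ j<r+1) j≢r)

swap0Word : ℕ → List ℕ
swap0Word m = ascRun 0 m ++ descRun 0 (pred m)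

act-swap0Word : ∀ m v → act (swap0Word m) v ≡ swapℕ 0 m v
act-swap0Word zero v with swapℕ 0 0 v | swap-view 0 0 v
... | _ | at-left v≡0      = v≡0
... | _ | at-right v≢0 v≡0 = ⊥-elim (v≢0 v≡0)
... | _ | away _ _         = refl
act-swap0Word (suc m) v = trans (act-++ asc desc v) (go v)
  where
  asc desc : List ℕ
  asc  = ascRun 0 (suc m)
  desc = descRun 0 m
  go : ∀ v → act asc (act desc v) ≡ swapℕ 0 (suc m) v
  go v with swapℕ 0 (suc m) v | swap-view 0 (suc m) v
  ... | _ | at-left refl =
    trans (cong (act asc) (descRun-bottom 0 m)) (ascRun-shift 0 (suc m) z≤n (n<1+n m))
  ... | _ | at-right _ refl =
    trans (cong (act asc) (descRun-above 0 m (n<1+n m))) (ascRun-top 0 (suc m))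
  ... | _ | away v≢0 v≢m+1 = fixed v v≢0 v≢m+1
    where
    fixed : ∀ v → v ≢ 0 → v ≢ suc m → act asc (act desc v) ≡ v
    fixed zero    v≢0 _ = ⊥-elim (v≢0 refl)
    fixed (suc u) _   u+1≢m+1 with <-cmp u m
    ... | tri< u<m _ _ = trans (cong (act asc) (descRun-shift 0 m z≤n u<m))
                               (ascRun-shift 0 (suc m) z≤n (m<n⇒m<1+n u<m))
    ... | tri≈ _ u≡m _ = ⊥-elim (u+1≢m+1 (cong suc u≡m))
    ... | tri> _ _ m<u = trans (cong (act asc) (descRun-above 0 m (m<n⇒m<1+n m<u)))
                               (ascRun-above 0 (suc m) (s≤s m<u))

tight-swap0Word : ∀ m → Tight (suc m) (swap0Word m)
tight-swap0Word zero    = z≤n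
tight-swap0Word (suc m) =
  tight-ascRun-++ (suc (suc m)) 0 (suc m) (tight-descRun _ 0 m (<-trans (n<1+n m) (n<1+n (suc m))))
    (n<1+n (suc m)) (descRun-above 0 m (n<1+n m)) preimage
  where
  preimage : ∀ {i} → 0 ≤ i → i < suc m → Σ ℕ λ P → P < suc m × act (descRun 0 m) P ≡ i
  preimage {i} _ i<m+1 with i ≟ m
  ... | yes refl = 0 , z<s , descRun-bottom 0 m
  ... | no i≢m   = suc i , s≤s i<m , descRun-shift 0 m z≤n i<m
    where
    i<m : i < m
    i<m = ≤∧≢⇒< (s≤s⁻¹ i<m+1) i≢m

ascRun-range : ∀ d r → All (λ ℓ → d ≤ ℓ × ℓ < d + r) (ascRun d r)
ascRun-range d zero    = []
ascRun-range d (suc r) = (≤-refl , m<m+n d z<s)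
  ∷ All.map (λ {ℓ} (d<ℓ , ℓ<) → <⇒≤ d<ℓ , subst (ℓ <_) (sym (+-suc d r)) ℓ<)
            (ascRun-range (suc d) r)

descRun-range : ∀ d r → All (λ ℓ → d ≤ ℓ × ℓ < d + r) (descRun d r)
descRun-range d zero    = []
descRun-range d (suc r) = (m≤m+n d r , subst (d + r <_) (sym (+-suc d r)) (n<1+n _))
  ∷ All.map (λ (d≤ℓ , ℓ<) → d≤ℓ , <-trans ℓ< (subst (d + r <_) (sym (+-suc d r)) (n<1+n _)))
            (descRun-range d r)

swap0Word-letters : ∀ m → All (_< m) (swap0Word m)
swap0Word-letters m =
  All.++⁺ (All.map proj₂ (ascRun-range 0 m))
          (All.map (λ (_ , ℓ<) → <-≤-trans ℓ< pred[n]≤n) (descRun-range 0 (pred m)))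

τ-preserves-≤ : ∀ {ℓ j v} → j ≢ ℓ → v ≤ j → τ ℓ v ≤ j
τ-preserves-≤ {ℓ} {j} {v} j≢ℓ v≤j with τ ℓ v | swap-view ℓ (suc ℓ) v
... | _ | at-left refl    = ≤∧≢⇒< v≤j (j≢ℓ ∘ sym)
... | _ | at-right _ refl = <⇒≤ v≤j
... | _ | away _ _        = v≤j

act-preserves-≤ : ∀ {j l v} → All (j ≢_) l → v ≤ j → act l v ≤ j
act-preserves-≤ []            v≤j = v≤j
act-preserves-≤ (j≢ℓ ∷ j∉l)   v≤j = τ-preserves-≤ j≢ℓ (act-preserves-≤ j∉l v≤j)

act-reflects-≤ : ∀ {j l v} → All (j ≢_) l → act l v ≤ j → v ≤ j
act-reflects-≤ []                  v≤j  = v≤j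
act-reflects-≤ {j} {ℓ ∷ l} {v} (j≢ℓ ∷ j∉l) ℓlv≤j =
  act-reflects-≤ j∉l (subst (_≤ j) (τ-involutive ℓ (act l v)) (τ-preserves-≤ j≢ℓ ℓlv≤j))

record Witness (m j a b : ℕ) : Set where
  field
    word  : List ℕ
    tight : Tight (suc m) word
    sub   : word ⊆ swap0Word m
    has-j : j ∈ word
    0↦a   : act word 0 ≡ a
    m↦b   : act word m ≡ b

module _ {m j t b : ℕ} (t<j : t < j) (j+1<m : suc j < m) (j<b : j < b) (b≤m : b ≤ m) where

  private
    headWord tailWord : List ℕ
    headWord = ascRun b (m ∸ b)
    tailWord = j ∷ descRun 0 t

    b+[m∸b]≡m : b + (m ∸ b) ≡ m
    b+[m∸b]≡m = m+[n∸m]≡n b≤m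

    j<m : j < m
    j<m = <-trans (n<1+n j) j+1<m

    tail-fixes-m : act tailWord m ≡ m
    tail-fixes-m = trans (cong (τ j) (descRun-above 0 t (<-trans t<j j<m))) (τ-above j j+1<m)

    tight-tail : Tight (suc m) tailWord
    tight-tail = tight-∷ (suc m) {ks = descRun 0 t}
      (tight-descRun (suc m) 0 t (<-trans (<-trans t<j j<m) (n<1+n m))) (n<1+n j)
      (m<n⇒m<1+n j+1<m) (descRun-above 0 t t<j) (descRun-above 0 t (m<n⇒m<1+n t<j))

  tailWord-⊆ : tailWord ⊆ descRun 0 (pred m)
  tailWord-⊆ = descRun-∷-⊆ (<⇒≤ t<j) (suc[m]≤n⇒m≤pred[n] j+1<m)

  wordBelow : List ℕ
  wordBelow = headWord ++ tailWord

  wordBelow-j+1 : act wordBelow (suc j) ≡ j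
  wordBelow-j+1 = begin
    act wordBelow (suc j)                           ≡⟨ act-++ headWord tailWord (suc j) ⟩
    act headWord (τ j (act (descRun 0 t) (suc j)))  ≡⟨ cong (act headWord ∘ τ j) t-fixes-j+1 ⟩
    act headWord (τ j (suc j))                      ≡⟨ cong (act headWord) (τ-right j) ⟩
    act headWord j                                  ≡⟨ ascRun-below b (m ∸ b) j<b ⟩
    j                                               ∎
    where
    open ≡-Reasoning
    t-fixes-j+1 : act (descRun 0 t) (suc j) ≡ suc j
    t-fixes-j+1 = descRun-above 0 t (m<n⇒m<1+n t<j)

  witnessBelow : Witness m j t b
  witnessBelow = record
    { word  = wordBelow
    ; tight = tight-ascRun-++ (suc m) b (m ∸ b) tight-tail (n<1+n m)
                (trans tail-fixes-m (sym b+[m∸b]≡m)) preimage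
    ; sub   = ++⁺ (ascRun-⊆ 0 m z≤n (≤-reflexive b+[m∸b]≡m)) tailWord-⊆
    ; has-j = ∈-++⁺ʳ headWord (here refl)
    ; 0↦a   = begin
        act wordBelow 0                        ≡⟨ act-++ headWord tailWord 0 ⟩
        act headWord (τ j (act (descRun 0 t) 0)) ≡⟨ cong (act headWord ∘ τ j) (descRun-bottom 0 t) ⟩
        act headWord (τ j t)                   ≡⟨ cong (act headWord) (τ-below j t<j) ⟩
        act headWord t                         ≡⟨ ascRun-below b (m ∸ b) (<-trans t<j j<b) ⟩
        t                                      ∎
    ; m↦b   = begin
        act wordBelow m                        ≡⟨ act-++ headWord tailWord m ⟩
        act headWord (act tailWord m)          ≡⟨ cong (act headWord) tail-fixes-m ⟩
        act headWord m                         ≡⟨ cong (act headWord) b+[m∸b]≡m ⟨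
        act headWord (b + (m ∸ b))             ≡⟨ ascRun-top b (m ∸ b) ⟩
        b                                      ∎
    }
    where
    open ≡-Reasoning
    preimage : ∀ {i} → b ≤ i → i < b + (m ∸ b) → Σ ℕ λ P → P < m × act tailWord P ≡ i
    preimage {i} b≤i i< = τ j i , τ-< j+1<m (subst (i <_) b+[m∸b]≡m i<) , (begin
      τ j (act (descRun 0 t) (τ j i))  ≡⟨ cong (τ j) (descRun-above 0 t t<τi) ⟩
      τ j (τ j i)                      ≡⟨ τ-involutive j i ⟩
      i                                ∎)
      where
      t<τi : t < τ j i
      t<τi = <-≤-trans t<j (τ-keeps-above j (<-≤-trans j<b b≤i))

-- For a = j the extra letter j - 1 moves the image j - 1 of 0 under wordBelow to j.
module _ {m j′ b : ℕ} (j+1<m : suc (suc j′) < m) (j<b : suc j′ < b) (b≤m : b ≤ m) where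

  private
    module W = Witness (witnessBelow (n<1+n j′) j+1<m j<b b≤m)

  witnessAt : Witness m (suc j′) (suc j′) b
  witnessAt = record
    { word  = j′ ∷ W.word
    ; tight = tight-∷ (suc m) {ks = W.word} W.tight z<s (m<n⇒m<1+n j+1<m) W.0↦a
                (wordBelow-j+1 (n<1+n j′) j+1<m j<b b≤m)
    ; sub   = ++⁺ (ascRun-∷-⊆ 0 m z≤n (<-trans (n<1+n j′) j<b) (≤-reflexive (m+[n∸m]≡n b≤m)))
                  (tailWord-⊆ (n<1+n j′) j+1<m j<b b≤m)
    ; has-j = there W.has-j
    ; 0↦a   = trans (cong (τ j′) W.0↦a) (τ-left j′)
    ; m↦b   = trans (cong (τ j′) W.m↦b) (τ-above j′ j<b)
    }

witness : ∀ {m j a b} → 1 ≤ j → suc j < m → a ≤ j → j < b → b ≤ m → Witness m j a b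
witness 1≤j j+1<m a≤j j<b b≤m with m≤n⇒m<n∨m≡n a≤j
... | inj₁ a<j  = witnessBelow a<j j+1<m j<b b≤m
witness (s≤s z≤n) j+1<m _ j<b b≤m | inj₂ refl = witnessAt j+1<m j<b b≤m

transpose-toℕ : ∀ {n} (i j k : Fin n) →
                toℕ (transpose i j ⟨$⟩ʳ k) ≡ swapℕ (toℕ i) (toℕ j) (toℕ k)
transpose-toℕ i j k with k F.≟ i
... | yes refl = sym (swapℕ-left (toℕ k) (toℕ j))
... | no k≢i with k F.≟ j
...   | yes refl = sym (swapℕ-right (toℕ i) (toℕ k))
...   | no k≢j   = sym (swapℕ-away (toℕ i) (toℕ j) (k≢i ∘ toℕ-injective) (k≢j ∘ toℕ-injective))

s-toℕ : ∀ {m} (k : Fin m) p → toℕ (s k ⟨$⟩ʳ p) ≡ τ (toℕ k) (toℕ p)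
s-toℕ k p = trans (transpose-toℕ (inject₁ k) (F.suc k) p)
                  (cong (λ a → swapℕ a (suc (toℕ k)) (toℕ p)) (toℕ-inject₁ k))

eval-toℕ : ∀ {m} (ws : Word m) p → toℕ (eval ws ⟨$⟩ʳ p) ≡ act (map toℕ ws) (toℕ p)
eval-toℕ []       p = refl
eval-toℕ (k ∷ ks) p = trans (s-toℕ k (eval ks ⟨$⟩ʳ p)) (cong (τ (toℕ k)) (eval-toℕ ks p))

eval-++ : ∀ {m} (xs ys : Word m) p → eval (xs ++ ys) ⟨$⟩ʳ p ≡ eval xs ⟨$⟩ʳ (eval ys ⟨$⟩ʳ p)
eval-++ []       ys p = refl
eval-++ (x ∷ xs) ys p = cong (s x ⟨$⟩ʳ_) (eval-++ xs ys p)

toℕ-letters : ∀ {m} (ws : Word m) → Letters< (suc m) (map toℕ ws)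
toℕ-letters []       = []
toℕ-letters (k ∷ ks) = s≤s (toℕ<n k) ∷ toℕ-letters ks

reduced-if-tight : ∀ {m} (ws : Word m) → Tight (suc m) (map toℕ ws) → Reduced ws
reduced-if-tight {m} ws tight vs vs≈ws = begin
  length ws                                  ≡⟨ length-map toℕ ws ⟨
  length (map toℕ ws)                        ≤⟨ tight ⟩
  inversions (suc m) (act (map toℕ ws))      ≡⟨ inversions-cong (suc m) same-action ⟩
  inversions (suc m) (act (map toℕ vs))      ≤⟨ inversions-act-≤-length (suc m) (toℕ-letters vs) ⟩
  length (map toℕ vs)                        ≡⟨ length-map toℕ vs ⟩
  length vs                                  ∎
  where
  open ≤-Reasoning
  same-action : ∀ {v} → v < suc m → act (map toℕ ws) v ≡ act (map toℕ vs) v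
  same-action {v} v<m+1 = begin-equality
    act (map toℕ ws) v                        ≡⟨ cong (act (map toℕ ws)) (toℕ-fromℕ< v<m+1) ⟨
    act (map toℕ ws) (toℕ (fromℕ< v<m+1))     ≡⟨ eval-toℕ ws _ ⟨
    toℕ (eval ws ⟨$⟩ʳ fromℕ< v<m+1)           ≡⟨ cong toℕ (vs≈ws _) ⟨
    toℕ (eval vs ⟨$⟩ʳ fromℕ< v<m+1)           ≡⟨ eval-toℕ vs _ ⟩
    act (map toℕ vs) (toℕ (fromℕ< v<m+1))     ≡⟨ cong (act (map toℕ vs)) (toℕ-fromℕ< v<m+1) ⟩
    act (map toℕ vs) v                        ∎

toWord : ∀ {m} (l : List ℕ) → All (_< m) l → Word m
toWord []      []          = []
toWord (k ∷ l) (k<m ∷ l<m) = fromℕ< k<m ∷ toWord l l<m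

map-toℕ-toWord : ∀ {m} l (l<m : All (_< m) l) → map toℕ (toWord l l<m) ≡ l
map-toℕ-toWord []      []          = refl
map-toℕ-toWord (k ∷ l) (k<m ∷ l<m) = cong₂ _∷_ (toℕ-fromℕ< k<m) (map-toℕ-toWord l l<m)

toWord-All : ∀ {m} {P : ℕ → Set} {l} (l<m : All (_< m) l) → All P l → All (P ∘ toℕ) (toWord l l<m)
toWord-All {P = P} (k<m ∷ l<m) (pk ∷ pl) = subst P (sym (toℕ-fromℕ< k<m)) pk ∷ toWord-All l<m pl
toWord-All []          []        = []

⊆-from-toℕ : ∀ {m} {us vs : List (Fin m)} → map toℕ us ⊆ map toℕ vs → us ⊆ vs
⊆-from-toℕ = Sublist.map toℕ-injective ∘ Sublist.map⁻ toℕ toℕ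

eval-toWord : ∀ {m} l (l<m : All (_< m) l) p → toℕ (eval (toWord l l<m) ⟨$⟩ʳ p) ≡ act l (toℕ p)
eval-toWord l l<m p =
  trans (eval-toℕ (toWord l l<m) p) (cong (λ w → act w (toℕ p)) (map-toℕ-toWord l l<m))

toWord-⊆ : ∀ {m l l′} (l<m : All (_< m) l) (l′<m : All (_< m) l′) → l ⊆ l′ →
           toWord l l<m ⊆ toWord l′ l′<m
toWord-⊆ {l = l} {l′} l<m l′<m l⊆l′ =
  ⊆-from-toℕ (subst₂ _⊆_ (sym (map-toℕ-toWord l l<m)) (sym (map-toℕ-toWord l′ l′<m)) l⊆l′)

descRun-letters : ∀ {m} q r → q + r < m → All (_< m) (descRun q r)
descRun-letters q r q+r<m = All.map (λ (_ , ℓ<q+r) → <-trans ℓ<q+r q+r<m) (descRun-range q r)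

descWord : ∀ {m} q r → q + r < m → Word m
descWord q r q+r<m = toWord (descRun q r) (descRun-letters q r q+r<m)

eval-descWord : ∀ {m} q r (q+r<m : q + r < m) p →
                toℕ (eval (descWord q r q+r<m) ⟨$⟩ʳ p) ≡ act (descRun q r) (toℕ p)
eval-descWord q r q+r<m = eval-toWord (descRun q r) (descRun-letters q r q+r<m)

descWord-Jmid : ∀ {m} q r (q+r<m : q + r < m) → 1 ≤ q → All Jmid (descWord q r q+r<m)
descWord-Jmid {m} q r q+r<m 1≤q = toWord-All (descRun-letters q r q+r<m)
  (All.map (λ {ℓ} (q≤ℓ , ℓ<q+r) → ≤-trans 1≤q q≤ℓ ,
                                   subst (_≤ m) (+-comm 2 ℓ) (≤-trans (s≤s ℓ<q+r) q+r<m))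
           (descRun-range q r))

perm-injective : ∀ {m} (π : S m) {x y} → π ⟨$⟩ʳ x ≡ π ⟨$⟩ʳ y → x ≡ y
perm-injective π {x} {y} eq = trans (sym (inverseˡ π)) (trans (cong (π ⟨$⟩ˡ_) eq) (inverseˡ π))

-- Phrased for π⁻¹ so that the induction in inverseInW-Jmid only composes on the left.
InverseInW : ∀ {m} → (Fin m → Set) → S m → Set
InverseInW {m} J π = Σ (Word m) λ ws → All J ws × (∀ i → eval ws ⟨$⟩ʳ (π ⟨$⟩ʳ i) ≡ i)

stays-in-middle : ∀ {m k} (π : S m) → π ⟨$⟩ʳ F.zero ≡ F.zero →
                  (∀ v → k < toℕ v → π ⟨$⟩ʳ v ≡ v) → ∀ v → 1 ≤ toℕ v → toℕ v ≤ k →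
                  1 ≤ toℕ (π ⟨$⟩ʳ v) × toℕ (π ⟨$⟩ʳ v) ≤ k
stays-in-middle {k = k} π fixes-0 fixes-above v 1≤v v≤k = 1≤πv , πv≤k
  where
  1≤πv : 1 ≤ toℕ (π ⟨$⟩ʳ v)
  1≤πv = n≢0⇒n>0 λ πv≡0 →
    <⇒≢ 1≤v (sym (cong toℕ (perm-injective π (trans (toℕ-injective πv≡0) (sym fixes-0)))))
  πv≤k : toℕ (π ⟨$⟩ʳ v) ≤ k
  πv≤k with toℕ (π ⟨$⟩ʳ v) ≤? k
  ... | yes πv≤k = πv≤k
  ... | no πv≰k  = ⊥-elim (<⇒≱ (subst (λ u → k < toℕ u) πv≡v (≰⇒> πv≰k)) v≤k)
    where
    πv≡v : π ⟨$⟩ʳ v ≡ v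
    πv≡v = perm-injective π (fixes-above (π ⟨$⟩ʳ v) (≰⇒> πv≰k))

-- A descending run carries π(k) back to k, leaving a permutation that also fixes k.
inverseInW-Jmid : ∀ {m} k → k < m → (π : S m) → π ⟨$⟩ʳ F.zero ≡ F.zero →
                  (∀ v → k < toℕ v → π ⟨$⟩ʳ v ≡ v) → InverseInW Jmid π
inverseInW-Jmid zero _ π fixes-0 fixes-above = [] , [] , fixes
  where
  fixes : ∀ i → π ⟨$⟩ʳ i ≡ i
  fixes F.zero    = fixes-0
  fixes (F.suc i) = fixes-above (F.suc i) z<s
inverseInW-Jmid {m} (suc h) k<m π fixes-0 fixes-above =
  extend (inverseInW-Jmid h (<-trans (n<1+n h) k<m) π′ fixes-0′ fixes-above′)
  where
  k : ℕ
  k = suc h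
  kF : Fin (suc m)
  kF = fromℕ< (m<n⇒m<1+n k<m)
  toℕ-kF : toℕ kF ≡ k
  toℕ-kF = toℕ-fromℕ< (m<n⇒m<1+n k<m)
  q r : ℕ
  q = toℕ (π ⟨$⟩ʳ kF)
  r = k ∸ q
  q-bounds : 1 ≤ q × q ≤ k
  q-bounds = stays-in-middle π fixes-0 fixes-above kF (subst (1 ≤_) (sym toℕ-kF) (s≤s z≤n))
                             (≤-reflexive toℕ-kF)
  q+r≡k : q + r ≡ k
  q+r≡k = m+[n∸m]≡n (proj₂ q-bounds)
  q+r<m : q + r < m
  q+r<m = subst (_< m) (sym q+r≡k) k<m
  desc : Word m
  desc = descWord q r q+r<m
  π′ : S m
  π′ = eval desc · π
  π′-acts : ∀ i → toℕ (π′ ⟨$⟩ʳ i) ≡ act (descRun q r) (toℕ (π ⟨$⟩ʳ i))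
  π′-acts i = eval-descWord q r q+r<m (π ⟨$⟩ʳ i)
  fixes-0′ : π′ ⟨$⟩ʳ F.zero ≡ F.zero
  fixes-0′ = toℕ-injective (trans (π′-acts F.zero)
               (trans (cong (act (descRun q r) ∘ toℕ) fixes-0) (descRun-below q r (proj₁ q-bounds))))
  fixes-above′ : ∀ v → h < toℕ v → π′ ⟨$⟩ʳ v ≡ v
  fixes-above′ v h<v with toℕ v ≟ k
  ... | yes v≡k = toℕ-injective (begin
    toℕ (π′ ⟨$⟩ʳ v)                     ≡⟨ π′-acts v ⟩
    act (descRun q r) (toℕ (π ⟨$⟩ʳ v))  ≡⟨ cong (act (descRun q r) ∘ toℕ ∘ (π ⟨$⟩ʳ_)) v≡kF ⟩
    act (descRun q r) q                 ≡⟨ descRun-bottom q r ⟩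
    q + r                               ≡⟨ trans q+r≡k (sym v≡k) ⟩
    toℕ v                               ∎)
    where
    open ≡-Reasoning
    v≡kF : v ≡ kF
    v≡kF = toℕ-injective (trans v≡k (sym toℕ-kF))
  ... | no v≢k = toℕ-injective (trans (π′-acts v)
    (trans (cong (act (descRun q r) ∘ toℕ) (fixes-above v k<v))
           (descRun-above q r (subst (_< toℕ v) (sym q+r≡k) k<v))))
    where
    k<v : k < toℕ v
    k<v = ≤∧≢⇒< h<v (v≢k ∘ sym)
  extend : InverseInW Jmid π′ → InverseInW Jmid π
  extend (ws , ws-J , ws-inverts) =
    ws ++ desc , All.++⁺ ws-J (descWord-Jmid q r q+r<m (proj₁ q-bounds)) ,
    λ i → trans (eval-++ ws desc (π ⟨$⟩ʳ i)) (ws-inverts i)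

sameCoset-refl : ∀ {m} {J : Fin m → Set} (x : S m) → SameCoset J x x
sameCoset-refl x = [] , [] , λ _ → sym (inverseˡ x)

sameCoset-if-ends-agree : ∀ {m} (x y : S (suc m)) → x ⟨$⟩ʳ F.zero ≡ y ⟨$⟩ʳ F.zero →
                          x ⟨$⟩ʳ fromℕ (suc m) ≡ y ⟨$⟩ʳ fromℕ (suc m) → SameCoset Jmid x y
sameCoset-if-ends-agree {m} x y same-0 same-top =
  toSameCoset (inverseInW-Jmid m (n<1+n m) π fixes-0 fixes-top)
  where
  π : S (suc m)
  π = (y ⁻¹) · x
  fixes-0 : π ⟨$⟩ʳ F.zero ≡ F.zero
  fixes-0 = trans (cong (y ⟨$⟩ˡ_) same-0) (inverseˡ y)
  fixes-top : ∀ v → m < toℕ v → π ⟨$⟩ʳ v ≡ v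
  fixes-top v m<v = trans (cong (λ u → y ⟨$⟩ˡ (x ⟨$⟩ʳ u)) v≡top)
                          (trans (cong (y ⟨$⟩ˡ_) same-top) (trans (inverseˡ y) (sym v≡top)))
    where
    v≡top : v ≡ fromℕ (suc m)
    v≡top = toℕ-injective (trans (≤-antisym (s≤s⁻¹ (toℕ<n v)) m<v) (sym (toℕ-fromℕ (suc m))))
  toSameCoset : InverseInW Jmid π → SameCoset Jmid x y
  toSameCoset (ws , ws-J , ws-inverts) = ws , ws-J , λ i → begin
    eval ws ⟨$⟩ʳ i                              ≡⟨ cong (eval ws ⟨$⟩ʳ_) (π-hits i) ⟨
    eval ws ⟨$⟩ʳ (π ⟨$⟩ʳ (x ⟨$⟩ˡ (y ⟨$⟩ʳ i)))  ≡⟨ ws-inverts _ ⟩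
    x ⟨$⟩ˡ (y ⟨$⟩ʳ i)                          ∎
    where
    open ≡-Reasoning
    π-hits : ∀ i → π ⟨$⟩ʳ (x ⟨$⟩ˡ (y ⟨$⟩ʳ i)) ≡ i
    π-hits i = trans (cong (y ⟨$⟩ˡ_) (inverseʳ x)) (inverseˡ y)

reduced-[] : ∀ {m} → Reduced {m} []
reduced-[] _ _ = z≤n

reduced-[_] : ∀ {m} (k : Fin m) → Reduced (k ∷ [])
reduced-[ k ] = reduced-if-tight (k ∷ [])
  (tight-∷ _ {ks = []} z≤n (n<1+n (toℕ k)) (s≤s (toℕ<n k)) refl refl)

e-≤B : ∀ {m} (v y : S m) → v ≤B y → e ≤B y
e-≤B _ _ (ws , _ , ws-reduced , ws≈y , _) =
  ws , [] , ws-reduced , ws≈y , minimum ws , reduced-[] , λ _ → refl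

swapWord : ∀ m → Word m
swapWord m = toWord (swap0Word m) (swap0Word-letters m)

swapWord-reduced : ∀ m → Reduced (swapWord m)
swapWord-reduced m = reduced-if-tight (swapWord m)
  (subst (Tight (suc m)) (sym (map-toℕ-toWord _ (swap0Word-letters m))) (tight-swap0Word m))

eval-swapWord : ∀ m → eval (swapWord m) ≈ w1n {m}
eval-swapWord m p = toℕ-injective (begin
  toℕ (eval (swapWord m) ⟨$⟩ʳ p)               ≡⟨ eval-toWord _ (swap0Word-letters m) p ⟩
  act (swap0Word m) (toℕ p)                    ≡⟨ act-swap0Word m (toℕ p) ⟩
  swapℕ 0 m (toℕ p)                 ≡⟨ cong (λ t → swapℕ 0 t (toℕ p)) (toℕ-fromℕ m) ⟨
  swapℕ 0 (toℕ (fromℕ m)) (toℕ p)              ≡⟨ transpose-toℕ F.zero (fromℕ m) p ⟨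
  toℕ (w1n ⟨$⟩ʳ p)                              ∎)
  where open ≡-Reasoning

module _ {m} (j : Fin (suc m)) (x : S (suc m))
         (W : Witness (suc m) (toℕ j) (toℕ (x ⟨$⟩ʳ F.zero)) (toℕ (x ⟨$⟩ʳ fromℕ (suc m)))) where

  open Witness W

  private
    letters : All (_< suc m) word
    letters = All-resp-⊆ sub (swap0Word-letters (suc m))
    yWord : Word (suc m)
    yWord = toWord word letters
    y : S (suc m)
    y = eval yWord
    yWord-reduced : Reduced yWord
    yWord-reduced =
      reduced-if-tight yWord (subst (Tight (suc (suc m))) (sym (map-toℕ-toWord word letters)) tight)
    j⊆yWord : j ∷ [] ⊆ yWord
    j⊆yWord = ⊆-from-toℕ (subst (toℕ j ∷ [] ⊆_) (sym (map-toℕ-toWord word letters)) (from∈ has-j))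
    y-agrees : ∀ {p} → toℕ (x ⟨$⟩ʳ p) ≡ act word (toℕ p) → x ⟨$⟩ʳ p ≡ y ⟨$⟩ʳ p
    y-agrees {p} eq = toℕ-injective (trans eq (sym (eval-toWord word letters p)))

  representative : Σ (S (suc m)) λ y → y ∈[ s j , w1n ] × SameCoset Jmid x y
  representative = y , (sj≤y , y≤w) , sameCoset-if-ends-agree x y
    (y-agrees (sym 0↦a))
    (y-agrees (sym (trans (cong (act word) (toℕ-fromℕ (suc m))) m↦b)))
    where
    sj≤y : s j ≤B y
    sj≤y = yWord , j ∷ [] , yWord-reduced , (λ _ → refl) , j⊆yWord , reduced-[ j ] , λ _ → refl
    y≤w : y ≤B w1n
    y≤w = swapWord (suc m) , yWord , swapWord-reduced (suc m) , eval-swapWord (suc m)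
        , toWord-⊆ letters (swap0Word-letters (suc m)) sub , yWord-reduced , λ _ → refl

ends-of-avoiding : ∀ {m} (j : Fin (suc m)) (x : S (suc m)) (us : Word (suc m)) →
                   eval us ≈ x → All (j ≢_) us →
                   toℕ (x ⟨$⟩ʳ F.zero) ≤ toℕ j × toℕ j < toℕ (x ⟨$⟩ʳ fromℕ (suc m))
ends-of-avoiding {m} j x us us≈x j∉us = 0↦≤j , j<top↦
  where
  j∉us′ : All (toℕ j ≢_) (map toℕ us)
  j∉us′ = All.map⁺ (All.map (_∘ toℕ-injective) j∉us)
  x-acts : ∀ p → toℕ (x ⟨$⟩ʳ p) ≡ act (map toℕ us) (toℕ p)
  x-acts p = trans (cong toℕ (sym (us≈x p))) (eval-toℕ us p)
  0↦≤j : toℕ (x ⟨$⟩ʳ F.zero) ≤ toℕ j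
  0↦≤j = subst (_≤ toℕ j) (sym (x-acts F.zero)) (act-preserves-≤ j∉us′ z≤n)
  top↦ : toℕ (x ⟨$⟩ʳ fromℕ (suc m)) ≡ act (map toℕ us) (suc m)
  top↦ = trans (x-acts (fromℕ (suc m))) (cong (act (map toℕ us)) (toℕ-fromℕ (suc m)))
  j<top↦ : toℕ j < toℕ (x ⟨$⟩ʳ fromℕ (suc m))
  j<top↦ = ≰⇒> λ top↦≤j →
    <⇒≱ (toℕ<n j) (act-reflects-≤ j∉us′ (subst (_≤ toℕ j) top↦ top↦≤j))

lift-to-[s,w] : ∀ {m} (j : Fin (suc m)) → Jmid j → (x : S (suc m)) → x ≤B w1n →
                Σ (S (suc m)) λ y → y ∈[ s j , w1n ] × SameCoset Jmid x y
lift-to-[s,w] {m} j (1≤j , j+2≤m+1) x x≤w@(_ , us , _ , _ , _ , us-reduced , us≈x)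
  with any? (j F.≟_) us
... | yes j∈us = x , (sj≤x , x≤w) , sameCoset-refl x
  where
  sj≤x : s j ≤B x
  sj≤x = us , j ∷ [] , us-reduced , us≈x , from∈ j∈us , reduced-[ j ] , λ _ → refl
... | no j∉us =
  representative j x (witness 1≤j j+1<m+1 (proj₁ ends) (proj₂ ends) (s≤s⁻¹ (toℕ<n _)))
  where
  j+1<m+1 : suc (toℕ j) < suc m
  j+1<m+1 = subst (_≤ suc m) (+-comm (toℕ j) 2) j+2≤m+1
  ends : toℕ (x ⟨$⟩ʳ F.zero) ≤ toℕ j × toℕ j < toℕ (x ⟨$⟩ʳ fromℕ (suc m))
  ends = ends-of-avoiding j x us us≈x (All.¬Any⇒All¬ us j∉us)

lemma5p19 : (m : ℕ) → 1 ≤ m → (j : Fin m) → Jmid j →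
    EqualModulo Jmid (e {m}) (s j) (w1n {m})
lemma5p19 zero    _ () _
lemma5p19 (suc m) _ j j-mid =
  (λ x (_ , x≤w) → lift-to-[s,w] j j-mid x x≤w) ,
  (λ y (sj≤y , y≤w) → y , (e-≤B (s j) y sj≤y , y≤w) , sameCoset-refl y)
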